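{- Let $n\ge 0$ and $0\le r\le n$, and let $\Gamma$ be any composite (in any order) of $r$ maps, each of which is $\Delta$ or $\Delta'$. Then the three multisets $$\{\!\{\Delta^r E\sigma:\sigma\in\mathfrak S_n\}\!\},\qquad \{\!\{\Delta'^r E\sigma:\sigma\in\mathfrak S_n\}\!\},\qquad \{\!\{\Gamma E\sigma:\sigma\in\mathfrak S_n\}\!\}$$ of vectors of $\mathbb N^{n-r}$ are equal.
   Context: For $n\ge 0$, $[n]=\{1,\dots,n\}$ and $\mathfrak S_n$ is the symmetric group on $[n]$. For $x\in\mathbb Z$, $x_+=\max\{0,x\}$. For $\sigma\in\mathfrak S_n$, $E\sigma=(E\sigma(1),\dots,E\sigma(n))\in\mathbb N^n$ where $E\sigma(k)=(\sigma(k)-(k-1))_+$. For $p\ge1$, the maps $\Delta,\Delta':\mathbb N^p\to\mathbb N^{p-1}$ are $\Delta(x_1,\dots,x_p)=((x_1-1)_+,\dots,(x_{p-1}-1)_+)$ and $\Delta'(x_1,\dots,x_p)=(x_2,\dots,x_p)$ (these two maps commute). A multiset $\{\!\{K\sigma:\sigma\in P\}\!\}$ records each value with multiplicity equal to the number of $\sigma\in P$ giving it. -}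

module Defs where

open import Data.Nat using (ℕ; zero; suc; _+_; _∸_; _≟_)
open import Data.Bool using (Bool; true; false; _∧_; not)
open import Data.List using (List; []; _∷_; map; concatMap; filter; length)
open import Data.Vec using (Vec; []; _∷_; toList)
open import Data.Fin using (Fin; toℕ)
open import Data.List.Relation.Binary.Permutation.Propositional using (_↭_)
open import Relation.Nullary.Decidable using (⌊_⌋)

range : ℕ → List ℕ
range zero = []
range (suc m) = zero ∷ map suc (range m)

words : ℕ → (k : ℕ) → List (Vec ℕ k)
words n zero = [] ∷ []
words n (suc k) = concatMap (λ w → map (λ i → suc i ∷ w) (range n)) (words n k)

notIn : ℕ → {k : ℕ} → Vec ℕ k → Bool
notIn x [] = true
notIn x (y ∷ ys) = not ⌊ x ≟ y ⌋ ∧ notIn x ys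

distinct : {k : ℕ} → Vec ℕ k → Bool
distinct [] = true
distinct (x ∷ xs) = notIn x xs ∧ distinct xs

-- 𝔖_n : every permutation σ listed exactly once, as its word (σ(1),…,σ(n))
Sym : (n : ℕ) → List (Vec ℕ n)
Sym n = filter (λ w → Data.Bool._≟_ (distinct w) true) (words n n)

-- E σ (k) = (σ(k) − (k−1))_+ ; truncated subtraction ∸ is exactly (·)_+
Eaux : ℕ → {k : ℕ} → Vec ℕ k → Vec ℕ k
Eaux j [] = []
Eaux j (x ∷ xs) = (x ∸ j) ∷ Eaux (suc j) xs

E : {n : ℕ} → Vec ℕ n → Vec ℕ n
E = Eaux zero

Δ : {p : ℕ} → Vec ℕ (suc p) → Vec ℕ p
Δ (x ∷ []) = []
Δ (x ∷ y ∷ ys) = (x ∸ 1) ∷ Δ (y ∷ ys)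

Δ′ : {p : ℕ} → Vec ℕ (suc p) → Vec ℕ p
Δ′ (x ∷ xs) = xs

-- a composite of r maps each Δ or Δ′ : a word in {Δ, Δ′} of length r
data Op : Set where
  opΔ opΔ′ : Op

apOp : Op → {p : ℕ} → Vec ℕ (suc p) → Vec ℕ p
apOp opΔ = Δ
apOp opΔ′ = Δ′

-- compose [g₁,…,g_r] = g_r ∘ … ∘ g₂ ∘ g₁  (the first in the list is applied first);
-- every order of composition arises from some list
compose : {r : ℕ} → Vec Op r → {m : ℕ} → Vec ℕ (r + m) → Vec ℕ m
compose [] x = x
compose (g ∷ gs) x = compose gs (apOp g x)

replicateOp : Op → (r : ℕ) → Vec Op r
replicateOp o zero = []
replicateOp o (suc r) = o ∷ replicateOp o r

-- the multiset {{ Γ E σ : σ ∈ 𝔖_{r+m} }} represented as a list up to permutation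
image : {r m : ℕ} → Vec Op r → List (Vec ℕ m)
image {r} {m} Γ = map (λ σ → compose Γ (E σ)) (Sym (r + m))

{-# OPTIONS --safe #-}
-- The rotation σ ↦ (σ(2),…,σ(n),σ(1)) is a bijection of 𝔖_n with Δ E(rot σ) = Δ′ E σ, so in
-- the multiset {{G (Δ′ E σ)}} the Δ′ may be replaced by Δ, whatever map G is applied afterwards.
-- Since Δ and Δ′ commute, each letter of Γ can in turn be moved next to E and replaced by Δ,
-- so {{Γ E σ}} = {{Δ^r E σ}} for every word Γ, in particular for Γ = Δ′^r.
module Submission where

open import Defs
open import Data.Nat using (ℕ; zero; suc; _+_; _∸_; _≟_)
open import Data.Vec using (Vec; []; _∷_; toList; _∷ʳ_)
open import Data.Product using (_×_; _,_)
open import Data.List.Relation.Binary.Permutation.Propositional using (_↭_)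

open import Algebra.Bundles using (CommutativeMonoid)
open import Data.Bool as Bool using (Bool; true; false; _∧_; not)
open import Data.Bool.Properties using (∧-comm; ∧-assoc; ∧-identityʳ; ∧-commutativeMonoid)
open import Data.List using (List; []; _∷_; map; concatMap; filter; _++_)
open import Data.List.Properties
  using (map-cong; map-∘; map-concatMap; concatMap-map; concatMap-cong; concatMap-++)
import Data.List.Relation.Binary.Permutation.Propositional as ↭
open ↭ using (↭-refl; ↭-sym; ↭-trans; ↭-reflexive; module PermutationReasoning)
open import Data.List.Relation.Binary.Permutation.Propositional.Properties
  using (map⁺; ++⁺ˡ; ++⁺; shifts; filter-↭)
open import Data.Nat.Properties using (∸-+-assoc; +-comm)
open import Function using (_∘_; id)
open import Relation.Binary.PropositionalEquality
  using (_≡_; refl; sym; trans; cong; cong₂; _≗_; module ≡-Reasoning)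
open import Relation.Nullary using (yes; no; contradiction)
open import Relation.Nullary.Decidable using (⌊_⌋)

open import Algebra.Properties.CommutativeSemigroup
  (CommutativeMonoid.commutativeSemigroup ∧-commutativeMonoid) using (interchange)

private
  variable
    A B C : Set
    k p r : ℕ

-- The letters are commuted on lists: on vectors the index r + m of compose is in the way.
Δˡ : List ℕ → List ℕ
Δˡ [] = []
Δˡ (x ∷ []) = []
Δˡ (x ∷ y ∷ ys) = (x ∸ 1) ∷ Δˡ (y ∷ ys)

Δ′ˡ : List ℕ → List ℕ
Δ′ˡ [] = []
Δ′ˡ (x ∷ xs) = xs

apOpˡ : Op → List ℕ → List ℕ
apOpˡ opΔ = Δˡ
apOpˡ opΔ′ = Δ′ˡ

composeˡ : Vec Op r → List ℕ → List ℕ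
composeˡ [] = id
composeˡ (g ∷ Γ) = composeˡ Γ ∘ apOpˡ g

Δˡ^ : ℕ → List ℕ → List ℕ
Δˡ^ r = composeˡ (replicateOp opΔ r)

Eˡ : Vec ℕ k → List ℕ
Eˡ σ = toList (E σ)

Δˡ-Δ′ˡ-comm : ∀ xs → Δˡ (Δ′ˡ xs) ≡ Δ′ˡ (Δˡ xs)
Δˡ-Δ′ˡ-comm [] = refl
Δˡ-Δ′ˡ-comm (x ∷ []) = refl
Δˡ-Δ′ˡ-comm (x ∷ y ∷ ys) = refl

apOpˡ-comm : ∀ g h xs → apOpˡ g (apOpˡ h xs) ≡ apOpˡ h (apOpˡ g xs)
apOpˡ-comm opΔ opΔ xs = refl
apOpˡ-comm opΔ opΔ′ xs = Δˡ-Δ′ˡ-comm xs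
apOpˡ-comm opΔ′ opΔ xs = sym (Δˡ-Δ′ˡ-comm xs)
apOpˡ-comm opΔ′ opΔ′ xs = refl

composeˡ-apOpˡ-comm : ∀ (Γ : Vec Op r) g xs → composeˡ Γ (apOpˡ g xs) ≡ apOpˡ g (composeˡ Γ xs)
composeˡ-apOpˡ-comm [] g xs = refl
composeˡ-apOpˡ-comm (h ∷ Γ) g xs =
  trans (cong (composeˡ Γ) (apOpˡ-comm h g xs)) (composeˡ-apOpˡ-comm Γ g (apOpˡ h xs))

toList-Δ : (v : Vec ℕ (suc p)) → toList (Δ v) ≡ Δˡ (toList v)
toList-Δ (x ∷ []) = refl
toList-Δ (x ∷ y ∷ ys) = cong (x ∸ 1 ∷_) (toList-Δ (y ∷ ys))

toList-apOp : ∀ g (v : Vec ℕ (suc p)) → toList (apOp g v) ≡ apOpˡ g (toList v)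
toList-apOp opΔ v = toList-Δ v
toList-apOp opΔ′ (x ∷ xs) = refl

toList-compose : ∀ (Γ : Vec Op r) {m} (v : Vec ℕ (r + m)) → toList (compose Γ v) ≡ composeˡ Γ (toList v)
toList-compose [] v = refl
toList-compose (g ∷ Γ) v = trans (toList-compose Γ (apOp g v)) (cong (composeˡ Γ) (toList-apOp g v))

listToVec : (m : ℕ) → List ℕ → Vec ℕ m
listToVec zero _ = []
listToVec (suc m) [] = 0 ∷ listToVec m []
listToVec (suc m) (x ∷ xs) = x ∷ listToVec m xs

listToVec-toList : ∀ {m} (v : Vec ℕ m) → listToVec m (toList v) ≡ v
listToVec-toList [] = refl
listToVec-toList (x ∷ v) = cong (x ∷_) (listToVec-toList v)

rotate : Vec A (suc k) → Vec A (suc k)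
rotate (x ∷ xs) = xs ∷ʳ x

m∸n∸1≡m∸[1+n] : ∀ m n → m ∸ n ∸ 1 ≡ m ∸ suc n
m∸n∸1≡m∸[1+n] m n = trans (∸-+-assoc m n 1) (cong (m ∸_) (+-comm n 1))

Δ-Eaux-∷ʳ : ∀ j x (xs : Vec ℕ k) → Δ (Eaux j (xs ∷ʳ x)) ≡ Eaux (suc j) xs
Δ-Eaux-∷ʳ j x [] = refl
Δ-Eaux-∷ʳ j x (y ∷ []) = cong (_∷ []) (m∸n∸1≡m∸[1+n] y j)
Δ-Eaux-∷ʳ j x (y ∷ y′ ∷ ys) = cong₂ _∷_ (m∸n∸1≡m∸[1+n] y j) (Δ-Eaux-∷ʳ (suc j) x (y′ ∷ ys))

Δ-E-rotate : (σ : Vec ℕ (suc k)) → Δ (E (rotate σ)) ≡ Δ′ (E σ)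
Δ-E-rotate (x ∷ xs) = Δ-Eaux-∷ʳ zero x xs

Δ′ˡ-Eˡ≡Δˡ-Eˡ-rotate : (σ : Vec ℕ (suc k)) → Δ′ˡ (Eˡ σ) ≡ Δˡ (Eˡ (rotate σ))
Δ′ˡ-Eˡ≡Δˡ-Eˡ-rotate σ = begin
  Δ′ˡ (Eˡ σ)                 ≡⟨ toList-apOp opΔ′ (E σ) ⟨
  toList (Δ′ (E σ))          ≡⟨ cong toList (Δ-E-rotate σ) ⟨
  toList (Δ (E (rotate σ)))  ≡⟨ toList-Δ (E (rotate σ)) ⟩
  Δˡ (Eˡ (rotate σ))         ∎
  where open ≡-Reasoning

≟-sym : ∀ x y → ⌊ x ≟ y ⌋ ≡ ⌊ y ≟ x ⌋
≟-sym x y with x ≟ y | y ≟ x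
... | yes _ | yes _ = refl
... | no _ | no _ = refl
... | yes x≡y | no y≢x = contradiction (sym x≡y) y≢x
... | no x≢y | yes y≡x = contradiction (sym y≡x) x≢y

notIn-∷ʳ : ∀ y x (xs : Vec ℕ k) → notIn y (xs ∷ʳ x) ≡ notIn y xs ∧ not ⌊ y ≟ x ⌋
notIn-∷ʳ y x [] = ∧-identityʳ _
notIn-∷ʳ y x (z ∷ zs) =
  trans (cong (not ⌊ y ≟ z ⌋ ∧_) (notIn-∷ʳ y x zs)) (sym (∧-assoc (not ⌊ y ≟ z ⌋) _ _))

distinct-rotate : (σ : Vec ℕ (suc k)) → distinct (rotate σ) ≡ distinct σ
distinct-rotate (x ∷ []) = refl
distinct-rotate (x ∷ y ∷ ys) = begin
  notIn y (ys ∷ʳ x) ∧ distinct (rotate (x ∷ ys))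
    ≡⟨ cong₂ _∧_ (notIn-∷ʳ y x ys) (distinct-rotate (x ∷ ys)) ⟩
  (notIn y ys ∧ not ⌊ y ≟ x ⌋) ∧ (notIn x ys ∧ distinct ys)
    ≡⟨ cong₂ _∧_ (∧-comm (notIn y ys) _) refl ⟩
  (not ⌊ y ≟ x ⌋ ∧ notIn y ys) ∧ (notIn x ys ∧ distinct ys)
    ≡⟨ interchange (not ⌊ y ≟ x ⌋) _ _ _ ⟩
  (not ⌊ y ≟ x ⌋ ∧ notIn x ys) ∧ (notIn y ys ∧ distinct ys)
    ≡⟨ cong (λ b → (not b ∧ notIn x ys) ∧ (notIn y ys ∧ distinct ys)) (≟-sym y x) ⟩
  (not ⌊ x ≟ y ⌋ ∧ notIn x ys) ∧ (notIn y ys ∧ distinct ys) ∎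
  where open ≡-Reasoning

concatMap⁺ : (f : A → List B) {xs ys : List A} → xs ↭ ys → concatMap f xs ↭ concatMap f ys
concatMap⁺ f ↭.refl = ↭-refl
concatMap⁺ f (↭.prep x p) = ++⁺ˡ (f x) (concatMap⁺ f p)
concatMap⁺ f (↭.swap x y p) =
  ↭-trans (shifts (f x) (f y)) (++⁺ˡ (f y) (++⁺ˡ (f x) (concatMap⁺ f p)))
concatMap⁺ f (↭.trans p q) = ↭-trans (concatMap⁺ f p) (concatMap⁺ f q)

concatMap-cong-↭ : {f g : A → List B} → (∀ x → f x ↭ g x) → ∀ xs → concatMap f xs ↭ concatMap g xs
concatMap-cong-↭ f↭g [] = ↭-refl
concatMap-cong-↭ f↭g (x ∷ xs) = ++⁺ (f↭g x) (concatMap-cong-↭ f↭g xs)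

concatMap-concatMap : (f : B → List C) (g : A → List B) →
  concatMap f ∘ concatMap g ≗ concatMap (concatMap f ∘ g)
concatMap-concatMap f g [] = refl
concatMap-concatMap f g (x ∷ xs) =
  trans (concatMap-++ f (g x) (concatMap g xs)) (cong (concatMap f (g x) ++_) (concatMap-concatMap f g xs))

concatMap-∷-↭ : (h : A → B) (g : A → List B) →
  ∀ xs → concatMap (λ x → h x ∷ g x) xs ↭ map h xs ++ concatMap g xs
concatMap-∷-↭ h g [] = ↭-refl
concatMap-∷-↭ h g (x ∷ xs) =
  ↭.prep (h x) (↭-trans (++⁺ˡ (g x) (concatMap-∷-↭ h g xs)) (shifts (g x) (map h xs)))

concatMap-map-swap : (f : A → B → C) (xs : List A) (ys : List B) →
  concatMap (λ x → map (f x) ys) xs ↭ concatMap (λ y → map (λ x → f x y) xs) ys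
concatMap-map-swap f [] ys = ↭-reflexive (sym (concatMap-[] ys))
  where
  concatMap-[] : ∀ (ys : List B) → concatMap (λ _ → []) ys ≡ []
  concatMap-[] [] = refl
  concatMap-[] (_ ∷ ys) = concatMap-[] ys
concatMap-map-swap f (x ∷ xs) ys =
  ↭-trans (++⁺ˡ (map (f x) ys) (concatMap-map-swap f xs ys))
          (↭-sym (concatMap-∷-↭ (f x) (λ y → map (λ x → f x y) xs) ys))

extendˡ extendʳ : ℕ → Vec ℕ k → List (Vec ℕ (suc k))
extendˡ n w = map (λ i → suc i ∷ w) (range n)
extendʳ n w = map (λ i → w ∷ʳ suc i) (range n)

extendˡ-extendʳ-comm : ∀ n (w : Vec ℕ k) →
  concatMap (extendˡ n) (extendʳ n w) ↭ concatMap (extendʳ n) (extendˡ n w)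
extendˡ-extendʳ-comm n w = begin
  concatMap (extendˡ n) (extendʳ n w)
    ≡⟨ concatMap-map (extendˡ n) (λ j → w ∷ʳ suc j) (range n) ⟩
  concatMap (λ j → map (λ i → suc i ∷ (w ∷ʳ suc j)) (range n)) (range n)
    ↭⟨ concatMap-map-swap (λ j i → suc i ∷ (w ∷ʳ suc j)) (range n) (range n) ⟩
  concatMap (λ i → map (λ j → suc i ∷ (w ∷ʳ suc j)) (range n)) (range n)
    ≡⟨ concatMap-map (extendʳ n) (λ i → suc i ∷ w) (range n) ⟨
  concatMap (extendʳ n) (extendˡ n w) ∎
  where open PermutationReasoning

words-extendʳ : ∀ n k → words n (suc k) ↭ concatMap (extendʳ n) (words n k)
words-extendʳ n zero = ↭-refl
words-extendʳ n (suc k) = begin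
  concatMap (extendˡ n) (words n (suc k))
    ↭⟨ concatMap⁺ (extendˡ n) (words-extendʳ n k) ⟩
  concatMap (extendˡ n) (concatMap (extendʳ n) (words n k))
    ≡⟨ concatMap-concatMap (extendˡ n) (extendʳ n) (words n k) ⟩
  concatMap (concatMap (extendˡ n) ∘ extendʳ n) (words n k)
    ↭⟨ concatMap-cong-↭ (extendˡ-extendʳ-comm n) (words n k) ⟩
  concatMap (concatMap (extendʳ n) ∘ extendˡ n) (words n k)
    ≡⟨ concatMap-concatMap (extendʳ n) (extendˡ n) (words n k) ⟨
  concatMap (extendʳ n) (words n (suc k)) ∎
  where open PermutationReasoning

map-rotate-words : ∀ n k → map rotate (words n (suc k)) ↭ words n (suc k)
map-rotate-words n k = begin
  map rotate (concatMap (extendˡ n) (words n k))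
    ≡⟨ map-concatMap rotate (extendˡ n) (words n k) ⟩
  concatMap (map rotate ∘ extendˡ n) (words n k)
    ≡⟨ concatMap-cong (λ w → map-∘ (range n)) (words n k) ⟨
  concatMap (extendʳ n) (words n k)
    ↭⟨ words-extendʳ n k ⟨
  words n (suc k) ∎
  where open PermutationReasoning

map-filter-invariant : (f : A → A) (b : A → Bool) → (∀ x → b (f x) ≡ b x) →
  map f ∘ filter (λ x → b x Bool.≟ true) ≗ filter (λ x → b x Bool.≟ true) ∘ map f
map-filter-invariant f b b∘f≡b [] = refl
map-filter-invariant f b b∘f≡b (x ∷ xs) with b (f x) | b x | b∘f≡b x
... | true | true | refl = cong (f x ∷_) (map-filter-invariant f b b∘f≡b xs)
... | false | false | refl = map-filter-invariant f b b∘f≡b xs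

map-rotate-Sym : ∀ k → map rotate (Sym (suc k)) ↭ Sym (suc k)
map-rotate-Sym k = begin
  map rotate (Sym (suc k))
    ≡⟨ map-filter-invariant rotate distinct distinct-rotate (words (suc k) (suc k)) ⟩
  filter (λ w → distinct w Bool.≟ true) (map rotate (words (suc k) (suc k)))
    ↭⟨ filter-↭ (λ w → distinct w Bool.≟ true) (map-rotate-words (suc k) k) ⟩
  Sym (suc k) ∎
  where open PermutationReasoning

image-Δ′ˡ↭image-Δˡ : ∀ n (G : List ℕ → B) → map (G ∘ Δ′ˡ ∘ Eˡ) (Sym n) ↭ map (G ∘ Δˡ ∘ Eˡ) (Sym n)
image-Δ′ˡ↭image-Δˡ zero G = ↭-refl
image-Δ′ˡ↭image-Δˡ (suc k) G = begin
  map (G ∘ Δ′ˡ ∘ Eˡ) (Sym (suc k))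
    ≡⟨ map-cong (cong G ∘ Δ′ˡ-Eˡ≡Δˡ-Eˡ-rotate) (Sym (suc k)) ⟩
  map (G ∘ Δˡ ∘ Eˡ ∘ rotate) (Sym (suc k))
    ≡⟨ map-∘ (Sym (suc k)) ⟩
  map (G ∘ Δˡ ∘ Eˡ) (map rotate (Sym (suc k)))
    ↭⟨ map⁺ (G ∘ Δˡ ∘ Eˡ) (map-rotate-Sym k) ⟩
  map (G ∘ Δˡ ∘ Eˡ) (Sym (suc k)) ∎
  where open PermutationReasoning

image-apOpˡ↭image-Δˡ : ∀ n g (G : List ℕ → B) →
  map (G ∘ apOpˡ g ∘ Eˡ) (Sym n) ↭ map (G ∘ Δˡ ∘ Eˡ) (Sym n)
image-apOpˡ↭image-Δˡ n opΔ G = ↭-refl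
image-apOpˡ↭image-Δˡ n opΔ′ G = image-Δ′ˡ↭image-Δˡ n G

image-composeˡ↭image-Δˡ^ : ∀ n (Γ : Vec Op r) (G : List ℕ → B) →
  map (G ∘ composeˡ Γ ∘ Eˡ) (Sym n) ↭ map (G ∘ Δˡ^ r ∘ Eˡ) (Sym n)
image-composeˡ↭image-Δˡ^ n [] G = ↭-refl
image-composeˡ↭image-Δˡ^ {r = suc r} n (g ∷ Γ) G = begin
  map (G ∘ composeˡ Γ ∘ apOpˡ g ∘ Eˡ) (Sym n)
    ≡⟨ map-cong (cong G ∘ composeˡ-apOpˡ-comm Γ g ∘ Eˡ) (Sym n) ⟩
  map (G ∘ apOpˡ g ∘ composeˡ Γ ∘ Eˡ) (Sym n)
    ↭⟨ image-composeˡ↭image-Δˡ^ n Γ (G ∘ apOpˡ g) ⟩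
  map (G ∘ apOpˡ g ∘ Δˡ^ r ∘ Eˡ) (Sym n)
    ≡⟨ map-cong (cong G ∘ composeˡ-apOpˡ-comm (replicateOp opΔ r) g ∘ Eˡ) (Sym n) ⟨
  map (G ∘ Δˡ^ r ∘ apOpˡ g ∘ Eˡ) (Sym n)
    ↭⟨ image-apOpˡ↭image-Δˡ n g (G ∘ Δˡ^ r) ⟩
  map (G ∘ Δˡ^ (suc r) ∘ Eˡ) (Sym n) ∎
  where open PermutationReasoning

image≡map-composeˡ : ∀ {m} (Γ : Vec Op r) →
  image {r} {m} Γ ≡ map (listToVec m ∘ composeˡ Γ ∘ Eˡ) (Sym (r + m))
image≡map-composeˡ {r} {m} Γ = map-cong compose≡ (Sym (r + m))
  where
  compose≡ : (σ : Vec ℕ (r + m)) → compose Γ (E σ) ≡ listToVec m (composeˡ Γ (Eˡ σ))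
  compose≡ σ = trans (sym (listToVec-toList (compose Γ (E σ))))
                     (cong (listToVec m) (toList-compose Γ (E σ)))

image↭image-Δ^ : ∀ {m} (Γ : Vec Op r) → image {r} {m} Γ ↭ image {r} {m} (replicateOp opΔ r)
image↭image-Δ^ {r} {m} Γ = begin
  image Γ
    ≡⟨ image≡map-composeˡ Γ ⟩
  map (listToVec m ∘ composeˡ Γ ∘ Eˡ) (Sym (r + m))
    ↭⟨ image-composeˡ↭image-Δˡ^ (r + m) Γ (listToVec m) ⟩
  map (listToVec m ∘ Δˡ^ r ∘ Eˡ) (Sym (r + m))
    ≡⟨ image≡map-composeˡ (replicateOp opΔ r) ⟨
  image (replicateOp opΔ r) ∎
  where open PermutationReasoning

theorem1p5 : (r m : ℕ) (Γ : Vec Op r) →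
    (image {r} {m} (replicateOp opΔ r) ↭ image {r} {m} (replicateOp opΔ′ r))
    × (image {r} {m} (replicateOp opΔ r) ↭ image {r} {m} Γ)
theorem1p5 r m Γ = ↭-sym (image↭image-Δ^ (replicateOp opΔ′ r)) , ↭-sym (image↭image-Δ^ Γ)
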